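{- Let $P$ be a finite poset. Then $N_{diag}(S_N(P))=A(P)$.
   Context: For a poset $P$, a covering pair is $(x,y)$ with $x<y$ and no $z$ with $x<z<y$; write $x\prec y$. $Diag(P)$ is the set of covering pairs of $P$, and $Inc(P)$ is the set of pairs of incomparable elements. Four elements $a,b,c,d\in P$ form an $N$ in $P$ if $b\prec c$, $a\prec c$, $b\prec d$ and $(a,d)\in Inc(P)$; the pair $(b,c)$ is called the diagonal edge of this $N$. $N_{diag}(P)$ denotes the set of diagonal edges of all $N$'s in $P$. $S_N(P)$ is the poset obtained from $P$ by adding exactly one new vertex $u_e$ on each edge $e=(x,y)\in N_{diag}(P)$ (replacing $x\prec y$ by $x\prec u_e\prec y$ in the diagram and taking the reflexive-transitive closure), and no vertex on other edges. $A(P)$ is the set of pairs $(b,c)\in Diag(P)\setminus N_{diag}(P)$ for which there exist $a,d\in P$ with $a<c$, $b<d$, $(a,b),(c,d)\in Inc(P)$, and either $(a,c)\in N_{diag}(P)$ or $(b,d)\in N_{diag}(P)$. -}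

module Defs where

open import Level using (0ℓ)
open import Data.Nat using (ℕ)
open import Data.Fin using (Fin; _≟_)
open import Data.Fin.Properties using (any?)
open import Data.Product using (_×_; _,_; ∃; ∃₂; Σ)
open import Data.Sum using (_⊎_; inj₁; inj₂)
open import Data.Empty using (⊥)
open import Relation.Nullary using (¬_; Dec; yes; no)
open import Relation.Nullary.Decidable using (True; _×-dec_; ¬?)
open import Relation.Binary using (Rel; Decidable)
open import Relation.Binary.PropositionalEquality using (_≡_; _≢_)
open import Relation.Binary.Construct.Closure.ReflexiveTransitive using (Star)

module _ {A : Set} (R : Rel A 0ℓ) where

  Lt : A → A → Set
  Lt x y = R x y × x ≢ y

  Cover : A → A → Set
  Cover x y = Lt x y × ¬ (∃ λ z → Lt x z × Lt z y)

  Inc : A → A → Set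
  Inc x y = ¬ R x y × ¬ R y x

  IsN : A → A → A → A → Set
  IsN a b c d = Cover b c × Cover a c × Cover b d × Inc a d

  NDiag : A → A → Set
  NDiag b c = ∃₂ λ a d → IsN a b c d

  APairs : A → A → Set
  APairs b c =
    Cover b c × ¬ NDiag b c ×
    ∃₂ λ a d → Lt a c × Lt b d × Inc a b × Inc c d × (NDiag a c ⊎ NDiag b d)

module _ {n : ℕ} (R : Rel (Fin n) 0ℓ) (R? : Decidable R) where

  lt? : Decidable (Lt R)
  lt? x y = R? x y ×-dec ¬? (x ≟ y)

  cover? : Decidable (Cover R)
  cover? x y = lt? x y ×-dec ¬? (any? λ z → lt? x z ×-dec lt? z y)

  inc? : Decidable (Inc R)
  inc? x y = ¬? (R? x y) ×-dec ¬? (R? y x)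

  ndiag? : Decidable (NDiag R)
  ndiag? b c = any? λ a → any? λ d →
    cover? b c ×-dec cover? a c ×-dec cover? b d ×-dec inc? a d

  -- The poset S_N(P): one new vertex u_e for every e ∈ N_diag(P).
  -- (True (ndiag? x y) is a proof-irrelevant unit type, so there is
  -- exactly one new vertex per diagonal edge.)

  NewVertex : Set
  NewVertex = Σ (Fin n × Fin n) λ { (x , y) → True (ndiag? x y) }

  SN : Set
  SN = Fin n ⊎ NewVertex

  -- covering diagram of S_N(P): old covers not in N_diag are kept,
  -- each e = (x , y) ∈ N_diag is replaced by x ≺ u_e ≺ y.
  SNDiagram : Rel SN 0ℓ
  SNDiagram (inj₁ x) (inj₁ y) = Cover R x y × ¬ NDiag R x y
  SNDiagram (inj₁ x) (inj₂ ((a , _) , _)) = x ≡ a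
  SNDiagram (inj₂ ((_ , b) , _)) (inj₁ y) = y ≡ b
  SNDiagram (inj₂ _) (inj₂ _) = ⊥

  SN≤ : Rel SN 0ℓ
  SN≤ = Star SNDiagram

-- A new vertex u_(x,y) of S_N(P) has x as its only lower and y as its only upper cover, so it
-- cannot be an end of the diagonal edge of an N; that edge is therefore an old cover b ≺ c of P
-- outside N_diag(P). Replacing the outer vertices a, d of the N by the old vertices just below a
-- and just above d witnesses (b,c) ∈ A(P), and one of a, d must be new, since otherwise the N
-- would already live in P. Conversely, for (b,c) ∈ A(P) the subdivided N-diagonal (a,c) or (b,d)
-- supplies one new outer vertex, and the other is an upper cover of b below d (resp. a lower cover
-- of c above a) in S_N(P); these two are incomparable because b ≺ c and because c ∥ d (resp. a ∥ b).
module Submission where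

open import Defs
open import Level using (0ℓ)
open import Data.Nat using (ℕ)
open import Data.Fin using (Fin)
open import Data.Fin.Properties using (any?)
open import Data.Fin.Induction using (po-wellFounded; po-noetherian)
open import Data.Product using (_×_; _,_; ∃; ∃₂; proj₁; proj₂)
open import Data.Sum using (inj₁; inj₂; _⊎_; [_,_])
open import Data.Sum.Properties using (inj₁-injective)
open import Data.Empty using (⊥; ⊥-elim)
open import Function using (_∘_; flip)
open import Induction.WellFounded using (Acc; acc)
open import Relation.Nullary using (¬_; Dec; yes; no)
open import Relation.Nullary.Decidable using (_×-dec_; toWitness; fromWitness; map′; decidable-stable)
open import Relation.Binary using (Rel; DecidableEquality; IsPartialOrder; IsDecPartialOrder; Antisymmetric; Trans)
open import Relation.Binary.PropositionalEquality as ≡ using (_≡_; _≢_; refl; sym; cong; subst; subst₂)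
open import Relation.Binary.Construct.Closure.ReflexiveTransitive using (Star; ε; _◅_; _◅◅_; fold; kleisliStar)
import Relation.Binary.Construct.Closure.ReflexiveTransitive.Properties as Star
import Relation.Binary.Construct.NonStrictToStrict as ToStrict

NDiag⇒Cover : ∀ {A : Set} {R : Rel A 0ℓ} {b c} → NDiag R b c → Cover R b c
NDiag⇒Cover (_ , _ , b⋖c , _) = b⋖c

module CoverProperties {A : Set} {_≤_ : Rel A 0ℓ} (isPO : IsPartialOrder _≡_ _≤_) where
  open IsPartialOrder isPO using (antisym; ≲-respʳ-≈) renaming (trans to ≤-trans)

  <-≤-trans : Trans (Lt _≤_) _≤_ (Lt _≤_)
  <-≤-trans = ToStrict.<-≤-trans _≡_ _≤_ sym ≤-trans antisym ≲-respʳ-≈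

  lower-covers-Inc : ∀ {a b c} → Cover _≤_ a c → Cover _≤_ b c → a ≢ b → Inc _≤_ a b
  lower-covers-Inc (a<c , a⋖c) (b<c , b⋖c) a≢b =
    (λ a≤b → a⋖c (_ , (a≤b , a≢b) , b<c)) , (λ b≤a → b⋖c (_ , (b≤a , a≢b ∘ sym) , a<c))

  upper-covers-Inc : ∀ {b c d} → Cover _≤_ b c → Cover _≤_ b d → c ≢ d → Inc _≤_ c d
  upper-covers-Inc (b<c , b⋖c) (b<d , b⋖d) c≢d =
    (λ c≤d → b⋖d (_ , b<c , (c≤d , c≢d))) , (λ d≤c → b⋖c (_ , b<d , (d≤c , c≢d ∘ sym)))

  cover-gap : ∀ {a b c d} → Cover _≤_ b c → Lt _≤_ b d → Lt _≤_ a c → ¬ d ≤ a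
  cover-gap (_ , b⋖c) b<d a<c d≤a = b⋖c (_ , <-≤-trans b<d d≤a , a<c)

  cover-squeeze : DecidableEquality A → ∀ {x y a b} →
    Cover _≤_ x y → x ≤ a → Lt _≤_ a b → b ≤ y → x ≡ a × b ≡ y
  cover-squeeze _≟_ {x} {y} {a} {b} (_ , x⋖y) x≤a a<b b≤y with x ≟ a | b ≟ y
  ... | yes x≡a | yes b≡y = x≡a , b≡y
  ... | no x≢a | _ = ⊥-elim (x⋖y (a , (x≤a , x≢a) , <-≤-trans a<b b≤y))
  ... | yes refl | no b≢y = ⊥-elim (x⋖y (b , a<b , (b≤y , b≢y)))

module FiniteCovers {n : ℕ} {_≤_ : Rel (Fin n) 0ℓ} (isPO : IsDecPartialOrder _≡_ _≤_) where
  open IsDecPartialOrder isPO using (isPartialOrder; _≟_; _≤?_)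
    renaming (refl to ≤-refl; trans to ≤-trans)

  private
    between? : ∀ x y → Dec (∃ λ z → Lt _≤_ x z × Lt _≤_ z y)
    between? x y = any? λ z → lt? _≤_ _≤?_ x z ×-dec lt? _≤_ _≤?_ z y

  cover-above : ∀ {b d} → Lt _≤_ b d → ∃ λ d' → Cover _≤_ b d' × d' ≤ d
  cover-above {b} {d} = go d (po-wellFounded isPartialOrder d)
    where
    go : ∀ d → Acc (Lt _≤_) d → Lt _≤_ b d → ∃ λ d' → Cover _≤_ b d' × d' ≤ d
    go d (acc rec) b<d with between? b d
    ... | no ∄z = d , (b<d , ∄z) , ≤-refl
    ... | yes (z , b<z , z<d) with go z (rec z<d) b<z
    ...   | d' , b⋖d' , d'≤z = d' , b⋖d' , ≤-trans d'≤z (proj₁ z<d)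

  cover-below : ∀ {a c} → Lt _≤_ a c → ∃ λ a' → a ≤ a' × Cover _≤_ a' c
  cover-below {a} {c} = go a (po-noetherian isPartialOrder a)
    where
    go : ∀ a → Acc (flip (Lt _≤_)) a → Lt _≤_ a c → ∃ λ a' → a ≤ a' × Cover _≤_ a' c
    go a (acc rec) a<c with between? a c
    ... | no ∄z = a , ≤-refl , (a<c , ∄z)
    ... | yes (z , a<z , z<c) with go z (rec a<z) z<c
    ...   | a' , z≤a' , a'⋖c = a' , ≤-trans (proj₁ a<z) z≤a' , a'⋖c

  ≤⇒Star-Cover : ∀ {x y} → x ≤ y → Star (Cover _≤_) x y
  ≤⇒Star-Cover {x} {y} = go y (po-wellFounded isPartialOrder y)
    where
    go : ∀ y → Acc (Lt _≤_) y → x ≤ y → Star (Cover _≤_) x y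
    go y (acc rec) x≤y with x ≟ y
    ... | yes refl = ε
    ... | no x≢y with cover-below (x≤y , x≢y)
    ...   | a , x≤a , a⋖y = go a (rec (proj₁ a⋖y)) x≤a ◅◅ (a⋖y ◅ ε)

module SubdividedPoset {n : ℕ} {_≤_ : Rel (Fin n) 0ℓ} (isPO : IsDecPartialOrder _≡_ _≤_) where
  open IsDecPartialOrder isPO using (isPartialOrder; _≟_; _≤?_; antisym)
    renaming (refl to ≤-refl; trans to ≤-trans)
  open CoverProperties isPartialOrder using (lower-covers-Inc; upper-covers-Inc; cover-squeeze)
  open FiniteCovers isPO using (cover-above; cover-below; ≤⇒Star-Cover)

  S : Set
  S = SN _≤_ _≤?_

  infix 4 _⊑_ _⊏_ _≼_

  _⊑_ : Rel S 0ℓ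
  _⊑_ = SN≤ _≤_ _≤?_

  _⊏_ : Rel S 0ℓ
  _⊏_ = Lt _⊑_

  new : ∀ {x y} → NDiag _≤_ x y → S
  new {x} {y} nd = inj₂ ((x , y) , fromWitness nd)

  -- The greatest old vertex below w and the least old vertex above it: x and y for w = u_(x,y).
  ⌊_⌋ ⌈_⌉ : S → Fin n
  ⌊ inj₁ x ⌋ = x
  ⌊ inj₂ ((x , _) , _) ⌋ = x
  ⌈ inj₁ x ⌉ = x
  ⌈ inj₂ ((_ , y) , _) ⌉ = y

  new-NDiag : ∀ u → NDiag _≤_ ⌊ inj₂ u ⌋ ⌈ inj₂ u ⌉
  new-NDiag ((_ , _) , t) = toWitness t

  new-Cover : ∀ u → Cover _≤_ ⌊ inj₂ u ⌋ ⌈ inj₂ u ⌉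
  new-Cover = NDiag⇒Cover ∘ new-NDiag

  ⌊⌋≤⌈⌉ : ∀ w → ⌊ w ⌋ ≤ ⌈ w ⌉
  ⌊⌋≤⌈⌉ (inj₁ x) = ≤-refl
  ⌊⌋≤⌈⌉ (inj₂ u) = proj₁ (proj₁ (new-Cover u))

  _≼_ : Rel S 0ℓ
  w ≼ w' = w ≡ w' ⊎ ⌈ w ⌉ ≤ ⌊ w' ⌋

  edge⇒⌈⌉≤⌊⌋ : ∀ {w v} → SNDiagram _≤_ _≤?_ w v → ⌈ w ⌉ ≤ ⌊ v ⌋
  edge⇒⌈⌉≤⌊⌋ {inj₁ x} {inj₁ y} ((x<y , _) , _) = proj₁ x<y
  edge⇒⌈⌉≤⌊⌋ {inj₁ x} {inj₂ v} refl = ≤-refl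
  edge⇒⌈⌉≤⌊⌋ {inj₂ u} {inj₁ y} refl = ≤-refl

  ⊑⇒≼ : ∀ {w w'} → w ⊑ w' → w ≼ w'
  ⊑⇒≼ = fold _≼_ step (inj₁ refl)
    where
    step : Trans (SNDiagram _≤_ _≤?_) _≼_ _≼_
    step e (inj₁ refl) = inj₂ (edge⇒⌈⌉≤⌊⌋ e)
    step {j = v} e (inj₂ ⌈v⌉≤) = inj₂ (≤-trans (edge⇒⌈⌉≤⌊⌋ e) (≤-trans (⌊⌋≤⌈⌉ v) ⌈v⌉≤))

  ⊑⌈⌉ : ∀ w → w ⊑ inj₁ ⌈ w ⌉
  ⊑⌈⌉ (inj₁ x) = ε
  ⊑⌈⌉ (inj₂ u) = refl ◅ ε

  ⌊⌋⊑ : ∀ w → inj₁ ⌊ w ⌋ ⊑ w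
  ⌊⌋⊑ (inj₁ x) = ε
  ⌊⌋⊑ (inj₂ u) = refl ◅ ε

  Cover⇒⊑ : ∀ {x y} → Cover _≤_ x y → inj₁ x ⊑ inj₁ y
  Cover⇒⊑ {x} {y} x⋖y with ndiag? _≤_ _≤?_ x y
  ... | yes nd = ⌊⌋⊑ (new nd) ◅◅ ⊑⌈⌉ (new nd)
  ... | no ¬nd = (x⋖y , ¬nd) ◅ ε

  ≤⇒⊑ : ∀ {x y} → x ≤ y → inj₁ x ⊑ inj₁ y
  ≤⇒⊑ = kleisliStar inj₁ Cover⇒⊑ ∘ ≤⇒Star-Cover

  ≼⇒⊑ : ∀ {w w'} → w ≼ w' → w ⊑ w'
  ≼⇒⊑ (inj₁ refl) = ε
  ≼⇒⊑ {w} {w'} (inj₂ ⌈w⌉≤⌊w'⌋) = ⊑⌈⌉ w ◅◅ ≤⇒⊑ ⌈w⌉≤⌊w'⌋ ◅◅ ⌊⌋⊑ w'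

  ⊑⇒≤ : ∀ {x y} → inj₁ x ⊑ inj₁ y → x ≤ y
  ⊑⇒≤ = [ (λ { refl → ≤-refl }) , (λ x≤y → x≤y) ] ∘ ⊑⇒≼

  ⊏⇒⌈⌉≤⌊⌋ : ∀ {w w'} → w ⊏ w' → ⌈ w ⌉ ≤ ⌊ w' ⌋
  ⊏⇒⌈⌉≤⌊⌋ (w⊑w' , w≢w') = [ ⊥-elim ∘ w≢w' , (λ le → le) ] (⊑⇒≼ w⊑w')

  <⇒⊏ : ∀ {x y} → Lt _≤_ x y → inj₁ x ⊏ inj₁ y
  <⇒⊏ (x≤y , x≢y) = ≤⇒⊑ x≤y , x≢y ∘ inj₁-injective

  ⊏⇒< : ∀ {x y} → inj₁ x ⊏ inj₁ y → Lt _≤_ x y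
  ⊏⇒< (x⊑y , x≢y) = ⊑⇒≤ x⊑y , x≢y ∘ cong inj₁

  -- only old vertices w satisfy ⌈ w ⌉ ≤ ⌊ w ⌋
  sandwiched : ∀ {w x} → ⌈ w ⌉ ≤ x → x ≤ ⌊ w ⌋ → w ≡ inj₁ x
  sandwiched {inj₁ y} y≤x x≤y = cong inj₁ (antisym y≤x x≤y)
  sandwiched {inj₂ u} ⌈u⌉≤x x≤⌊u⌋ =
    ⊥-elim (ToStrict.<⇒≱ _≡_ _≤_ antisym (proj₁ (new-Cover u)) (≤-trans ⌈u⌉≤x x≤⌊u⌋))

  ⊑-antisym : Antisymmetric _≡_ _⊑_
  ⊑-antisym {w} {w'} w⊑w' w'⊑w with ⊑⇒≼ w⊑w' | ⊑⇒≼ w'⊑w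
  ... | inj₁ w≡w' | _ = w≡w'
  ... | inj₂ _ | inj₁ w'≡w = sym w'≡w
  ... | inj₂ ⌈w⌉≤⌊w'⌋ | inj₂ ⌈w'⌉≤⌊w⌋ =
    ≡.trans (sandwiched ≤-refl (≤-trans ⌈w⌉≤⌊w'⌋ (≤-trans (⌊⌋≤⌈⌉ w') ⌈w'⌉≤⌊w⌋)))
            (sym (sandwiched (≤-trans ⌈w'⌉≤⌊w⌋ (⌊⌋≤⌈⌉ w)) ⌈w⌉≤⌊w'⌋))

  ⊑-isPartialOrder : IsPartialOrder _≡_ _⊑_
  ⊑-isPartialOrder = record { isPreorder = Star.isPreorder _ ; antisym = ⊑-antisym }

  open CoverProperties ⊑-isPartialOrder using (cover-gap)

  ⌊⌋⋖new : ∀ u → Cover _⊑_ (inj₁ ⌊ inj₂ u ⌋) (inj₂ u)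
  ⌊⌋⋖new u = (⌊⌋⊑ (inj₂ u) , λ ()) ,
    λ { (z , x⊏z , z⊏u) → proj₂ x⊏z (sym (sandwiched (⊏⇒⌈⌉≤⌊⌋ z⊏u) (⊏⇒⌈⌉≤⌊⌋ x⊏z))) }

  new⋖⌈⌉ : ∀ u → Cover _⊑_ (inj₂ u) (inj₁ ⌈ inj₂ u ⌉)
  new⋖⌈⌉ u = (⊑⌈⌉ (inj₂ u) , λ ()) ,
    λ { (z , u⊏z , z⊏y) → proj₂ z⊏y (sandwiched (⊏⇒⌈⌉≤⌊⌋ z⊏y) (⊏⇒⌈⌉≤⌊⌋ u⊏z)) }

  private
    ≟-old : (w : S) (x : Fin n) → Dec (w ≡ inj₁ x)
    ≟-old (inj₁ y) x = map′ (cong inj₁) inj₁-injective (y ≟ x)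
    ≟-old (inj₂ _) x = no λ ()

  ⋖new⇒⌊⌋ : ∀ {w u} → Cover _⊑_ w (inj₂ u) → w ≡ inj₁ ⌊ inj₂ u ⌋
  ⋖new⇒⌊⌋ {w} {u} (w⊏u , w⋖u) = decidable-stable (≟-old w ⌊ inj₂ u ⌋) λ w≢⌊u⌋ →
    w⋖u (_ , (≼⇒⊑ (inj₂ (⊏⇒⌈⌉≤⌊⌋ w⊏u)) , w≢⌊u⌋) , proj₁ (⌊⌋⋖new u))

  new⋖⇒⌈⌉ : ∀ {w u} → Cover _⊑_ (inj₂ u) w → w ≡ inj₁ ⌈ inj₂ u ⌉
  new⋖⇒⌈⌉ {w} {u} (u⊏w , u⋖w) = decidable-stable (≟-old w ⌈ inj₂ u ⌉) λ w≢⌈u⌉ →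
    u⋖w (_ , proj₁ (new⋖⌈⌉ u) , (≼⇒⊑ (inj₂ (⊏⇒⌈⌉≤⌊⌋ u⊏w)) , w≢⌈u⌉ ∘ sym))

  old⋖old⇒ : ∀ {x y} → Cover _⊑_ (inj₁ x) (inj₁ y) → Cover _≤_ x y × ¬ NDiag _≤_ x y
  old⋖old⇒ (x⊏y , x⋖y) =
    (⊏⇒< x⊏y , λ { (z , x<z , z<y) → x⋖y (inj₁ z , <⇒⊏ x<z , <⇒⊏ z<y) }) ,
    λ nd → x⋖y (new nd , proj₁ (⌊⌋⋖new _) , proj₁ (new⋖⌈⌉ _))

  old⋖old⇐ : ∀ {x y} → Cover _≤_ x y → ¬ NDiag _≤_ x y → Cover _⊑_ (inj₁ x) (inj₁ y)
  old⋖old⇐ {x} {y} x⋖y ¬nd = <⇒⊏ (proj₁ x⋖y) , λ { (z , x⊏z , z⊏y) → nothing-between z x⊏z z⊏y }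
    where
    nothing-between : ∀ z → inj₁ x ⊏ z → z ⊏ inj₁ y → ⊥
    nothing-between (inj₁ z) x⊏z z⊏y = proj₂ x⋖y (z , ⊏⇒< x⊏z , ⊏⇒< z⊏y)
    nothing-between (inj₂ u) x⊏u u⊏y
      with cover-squeeze _≟_ x⋖y (⊏⇒⌈⌉≤⌊⌋ x⊏u) (proj₁ (new-Cover u)) (⊏⇒⌈⌉≤⌊⌋ u⊏y)
    ... | x≡⌊u⌋ , ⌈u⌉≡y = ¬nd (subst₂ (NDiag _≤_) (sym x≡⌊u⌋) ⌈u⌉≡y (new-NDiag u))

  ⋖old⇒ : ∀ {w c} → Cover _⊑_ w (inj₁ c) → Cover _≤_ ⌊ w ⌋ c × (w ≡ inj₁ ⌊ w ⌋ ⊎ NDiag _≤_ ⌊ w ⌋ c)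
  ⋖old⇒ {inj₁ a} a⋖c = proj₁ (old⋖old⇒ a⋖c) , inj₁ refl
  ⋖old⇒ {inj₂ u} u⋖c with new⋖⇒⌈⌉ u⋖c
  ... | refl = new-Cover u , inj₂ (new-NDiag u)

  old⋖⇒ : ∀ {b w} → Cover _⊑_ (inj₁ b) w → Cover _≤_ b ⌈ w ⌉ × (w ≡ inj₁ ⌈ w ⌉ ⊎ NDiag _≤_ b ⌈ w ⌉)
  old⋖⇒ {w = inj₁ d} b⋖d = proj₁ (old⋖old⇒ b⋖d) , inj₁ refl
  old⋖⇒ {w = inj₂ u} b⋖u with ⋖new⇒⌊⌋ b⋖u
  ... | refl = new-Cover u , inj₂ (new-NDiag u)

  cover-above-in-SN : ∀ {b d} → Lt _≤_ b d → ∃ λ D → Cover _⊑_ (inj₁ b) D × ⌈ D ⌉ ≤ d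
  cover-above-in-SN {b} b<d with cover-above b<d
  ... | d' , b⋖d' , d'≤d with ndiag? _≤_ _≤?_ b d'
  ...   | yes nd = new nd , ⌊⌋⋖new ((b , d') , fromWitness nd) , d'≤d
  ...   | no ¬nd = inj₁ d' , old⋖old⇐ b⋖d' ¬nd , d'≤d

  cover-below-in-SN : ∀ {a c} → Lt _≤_ a c → ∃ λ A → Cover _⊑_ A (inj₁ c) × a ≤ ⌊ A ⌋
  cover-below-in-SN {c = c} a<c with cover-below a<c
  ... | a' , a≤a' , a'⋖c with ndiag? _≤_ _≤?_ a' c
  ...   | yes nd = new nd , new⋖⌈⌉ ((a' , c) , fromWitness nd) , a≤a'
  ...   | no ¬nd = inj₁ a' , old⋖old⇐ a'⋖c ¬nd , a≤a'

  NDiag⇒old : ∀ {w w'} → NDiag _⊑_ w w' → ∃₂ λ b c → w ≡ inj₁ b × w' ≡ inj₁ c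
  NDiag⇒old {inj₁ b} {inj₁ c} _ = b , c , refl , refl
  NDiag⇒old {w} {inj₂ u} (a , d , w⋖u , a⋖u , w⋖d , (a⋢d , _)) =
    ⊥-elim (a⋢d (subst (_⊑ d) (≡.trans (⋖new⇒⌊⌋ w⋖u) (sym (⋖new⇒⌊⌋ a⋖u))) (proj₁ (proj₁ w⋖d))))
  NDiag⇒old {inj₂ u} {w'} (a , d , u⋖w' , a⋖w' , u⋖d , (a⋢d , _)) =
    ⊥-elim (a⋢d (subst (a ⊑_) (≡.trans (new⋖⇒⌈⌉ u⋖w') (sym (new⋖⇒⌈⌉ u⋖d))) (proj₁ (proj₁ a⋖w'))))

  old-NDiag⇒APairs : ∀ {b c} → NDiag _⊑_ (inj₁ b) (inj₁ c) → APairs _≤_ b c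
  old-NDiag⇒APairs {b} {c} (a , d , b⋖c , a⋖c , b⋖d , (a⋢d , d⋢a))
    with old⋖old⇒ b⋖c | ⋖old⇒ a⋖c | old⋖⇒ b⋖d
  ... | b⋖′c , ¬nd | ⌊a⌋⋖c , a-old⊎nd | b⋖⌈d⌉ , d-old⊎nd =
    b⋖′c , ¬nd , ⌊ a ⌋ , ⌈ d ⌉ , proj₁ ⌊a⌋⋖c , proj₁ b⋖⌈d⌉ ,
    lower-covers-Inc ⌊a⌋⋖c b⋖′c ⌊a⌋≢b , upper-covers-Inc b⋖′c b⋖⌈d⌉ c≢⌈d⌉ ,
    an-end-is-new a-old⊎nd d-old⊎nd
    where
    ⌊a⌋≢b : ⌊ a ⌋ ≢ b
    ⌊a⌋≢b ⌊a⌋≡b =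
      [ (λ a≡⌊a⌋ → a⋢d (subst (_⊑ d) (sym (≡.trans a≡⌊a⌋ (cong inj₁ ⌊a⌋≡b))) (proj₁ (proj₁ b⋖d))))
      , ¬nd ∘ subst (λ x → NDiag _≤_ x c) ⌊a⌋≡b ] a-old⊎nd
    c≢⌈d⌉ : c ≢ ⌈ d ⌉
    c≢⌈d⌉ c≡⌈d⌉ =
      [ (λ d≡⌈d⌉ → a⋢d (subst (a ⊑_) (≡.trans (cong inj₁ c≡⌈d⌉) (sym d≡⌈d⌉)) (proj₁ (proj₁ a⋖c))))
      , ¬nd ∘ subst (NDiag _≤_ b) (sym c≡⌈d⌉) ] d-old⊎nd
    an-end-is-new : a ≡ inj₁ ⌊ a ⌋ ⊎ NDiag _≤_ ⌊ a ⌋ c → d ≡ inj₁ ⌈ d ⌉ ⊎ NDiag _≤_ b ⌈ d ⌉ →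
      NDiag _≤_ ⌊ a ⌋ c ⊎ NDiag _≤_ b ⌈ d ⌉
    an-end-is-new (inj₂ nd) _ = inj₁ nd
    an-end-is-new (inj₁ _) (inj₂ nd) = inj₂ nd
    an-end-is-new (inj₁ a≡⌊a⌋) (inj₁ d≡⌈d⌉) =
      ⊥-elim (¬nd (⌊ a ⌋ , ⌈ d ⌉ , b⋖′c , ⌊a⌋⋖c , b⋖⌈d⌉ ,
        (a⋢d ∘ subst₂ _⊑_ (sym a≡⌊a⌋) (sym d≡⌈d⌉) ∘ ≤⇒⊑) ,
        (d⋢a ∘ subst₂ _⊑_ (sym d≡⌈d⌉) (sym a≡⌊a⌋) ∘ ≤⇒⊑)))

  NDiag-through : ∀ {b c A D} → Cover _≤_ b c → ¬ NDiag _≤_ b c →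
    Cover _⊑_ A (inj₁ c) → Cover _⊑_ (inj₁ b) D → ¬ ⌈ A ⌉ ≤ ⌊ D ⌋ → NDiag _⊑_ (inj₁ b) (inj₁ c)
  NDiag-through {A = A} {D} b⋖c ¬nd A⋖c b⋖D ⌈A⌉≰⌊D⌋ = A , D , b⋖′c , A⋖c , b⋖D , A⋢D , D⋢A
    where
    b⋖′c : Cover _⊑_ (inj₁ _) (inj₁ _)
    b⋖′c = old⋖old⇐ b⋖c ¬nd
    D⋢A : ¬ D ⊑ A
    D⋢A = cover-gap b⋖′c (proj₁ b⋖D) (proj₁ A⋖c)
    A⋢D : ¬ A ⊑ D
    A⋢D A⊑D = [ (λ A≡D → D⋢A (subst (_⊑ A) A≡D ε)) , ⌈A⌉≰⌊D⌋ ] (⊑⇒≼ A⊑D)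

  APairs⇒NDiag : ∀ {b c} → APairs _≤_ b c → NDiag _⊑_ (inj₁ b) (inj₁ c)
  APairs⇒NDiag (b⋖c , ¬nd , a , d , a<c , b<d , (a≰b , _) , (c≰d , _) , inj₁ nd)
    with cover-above-in-SN b<d
  ... | D , b⋖D , ⌈D⌉≤d = NDiag-through b⋖c ¬nd (new⋖⌈⌉ ((a , _) , fromWitness nd)) b⋖D
    λ c≤⌊D⌋ → c≰d (≤-trans c≤⌊D⌋ (≤-trans (⌊⌋≤⌈⌉ D) ⌈D⌉≤d))
  APairs⇒NDiag (b⋖c , ¬nd , a , d , a<c , b<d , (a≰b , _) , (c≰d , _) , inj₂ nd)
    with cover-below-in-SN a<c
  ... | A , A⋖c , a≤⌊A⌋ = NDiag-through b⋖c ¬nd A⋖c (⌊⌋⋖new ((_ , d) , fromWitness nd))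
    λ ⌈A⌉≤b → a≰b (≤-trans a≤⌊A⌋ (≤-trans (⌊⌋≤⌈⌉ A) ⌈A⌉≤b))

lemma3 : (n : ℕ) (_≤_ : Rel (Fin n) 0ℓ) (isPO : IsDecPartialOrder _≡_ _≤_) →
    let R? = IsDecPartialOrder._≤?_ isPO in
    ((x y : SN _≤_ R?) → NDiag (SN≤ _≤_ R?) x y →
       ∃₂ λ b c → x ≡ inj₁ b × y ≡ inj₁ c × APairs _≤_ b c)
    × ((b c : Fin n) → APairs _≤_ b c → NDiag (SN≤ _≤_ R?) (inj₁ b) (inj₁ c))
lemma3 n _≤_ isPO = NDiag⊆A , λ _ _ → APairs⇒NDiag
  where
  open SubdividedPoset isPO
  NDiag⊆A : ∀ x y → NDiag _⊑_ x y → ∃₂ λ b c → x ≡ inj₁ b × y ≡ inj₁ c × APairs _≤_ b c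
  NDiag⊆A x y nd with NDiag⇒old nd
  ... | b , c , refl , refl = b , c , refl , refl , old-NDiag⇒APairs nd
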